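{- Let $(S,\Sigma)$ be a typed signature, i.e. $S$ is an algebraic signature and $\Sigma$ is a family of classic arities over $S$ (all notions as in the context). Then the category $\mathrm{Rep}^{\Delta}(S,\Sigma)$ of representations of $(S,\Sigma)$ in reduction monads has an initial object.
   Context: Categories. $\mathsf{Set}$ is the category of sets; $\mathsf{PO}$ is the category of preordered sets and monotone maps. $\Delta:\mathsf{Set}\to\mathsf{PO}$ sends a set $X$ to $X$ with the discrete (equality) preorder; it is left adjoint to the forgetful functor $U$. For a set $T$, $\mathsf{Set}^T$ (resp. $\mathsf{PO}^T$) is the category of $T$-indexed families of sets (resp. preorders) with sortwise maps; $\Delta^T:\mathsf{Set}^T\to\mathsf{PO}^T$ applies $\Delta$ sortwise. Hom-sets $\mathsf{PO}^T(A,B)$ are preordered pointwise: $f\le g$ iff $f_t(a)\le g_t(a)$ for all $t,a$. Relative monads. A relative monad $P$ on a functor $F:\mathcal C\to\mathcal D$ consists of an object map $P:\mathrm{Ob}\,\mathcal C\to\mathrm{Ob}\,\mathcal D$, morphisms $\eta_c:Fc\to Pc$, and maps $\sigma_{c,d}:\mathcal D(Fc,Pd)\to\mathcal D(Pc,Pd)$ such that $\eta_c;\sigma(f)=f$, $\sigma(\eta_c)=\mathrm{id}_{Pc}$, and $\sigma(f);\sigma(g)=\sigma(f;\sigma(g))$ (composition written diagrammatically). A reduction monad over $T$ is a relative monad on $\Delta^T$ such that each $\sigma_{X,Y}:\mathsf{PO}^T(\Delta^TX,PY)\to\mathsf{PO}^T(PX,PY)$ is monotone for the pointwise preorders. A relative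 monad $P$ on $F$ is a functor via $P(f)=\sigma(Ff;\eta)$. Modules. A module $M$ over a relative monad $P$ on $F:\mathcal C\to\mathcal D$ with codomain $\mathcal E$ is an object map $M:\mathrm{Ob}\,\mathcal C\to\mathrm{Ob}\,\mathcal E$ with maps $\varsigma_{c,d}:\mathcal D(Fc,Pd)\to\mathcal E(Mc,Md)$ satisfying $\varsigma(f);\varsigma(g)=\varsigma(f;\sigma(g))$ and $\varsigma(\eta_c)=\mathrm{id}$. A morphism of $P$-modules $\rho:M\to N$ is a family $\rho_c:Mc\to Nc$ with $\varsigma^M(f);\rho_d=\rho_c;\varsigma^N(f)$. Constructions (for $P$ a reduction monad over $T$): the tautological module $P$ (with $\varsigma=\sigma$); the terminal module $*$ (constant singleton); products of modules (objectwise); for $t\in T$ and a module $M$ with codomain $\mathsf{PO}^T$, the fibre $M_t$, $M_t(V)=M(V)(t)$; for $s\in T$ the derived module $M^s(V)=M(V^{*s})$ where $V^{*s}=V+D(s)$ adds one fresh variable $*$ of sort $s$, with substitution $\varsigma^{M^s}(f)=\varsigma^M(\mathrm{shift}(f))$, where $\mathrm{shift}(f):\Delta^T(V^{*s})\to P(W^{*s})$ sends old variables $v$ to $P(\mathrm{inl})(f(v))$ and $*$ to $\eta(\mathrm{inr}(*))$; iterated derivation $M^{s_1\ldots s_m}$. Algebraic signatures. An algebraic signature $S$ is a map $S:J_S\to\mathbb N$; a representation is a set $T$ with operations $j^T:T^{S(j)}\to T$; morphisms are maps commuting with the operations. $\hat S$ denotes the initial representation (the closed types). $S(n)$ is the set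 of type expressions built from the operations of $S$ and variables $1,\dots,n$; given a representation $T$ and $\vec u\in T^n$, each $s\in S(n)$ evaluates to $s(\vec u)\in T$. For a map $g:T\to T'$ the retyping functor $g_!:\mathsf{C}^T\to \mathsf{C}^{T'}$ (for $\mathsf C=\mathsf{Set}$ or $\mathsf{PO}$) is $(g_!V)(t')=\coprod_{g(t)=t'}V(t)$, left adjoint to precomposition with $g$; note $g_!\Delta^T=\Delta^{T'}g_!$. Relative $S$-monads. A relative $S$-monad is a pair $(T,P)$ of a representation $T$ of $S$ and a reduction monad $P$ over $T$. A morphism $(T,P)\to(T',Q)$ is a pair $(g,f)$ with $g:T\to T'$ a morphism of $S$-representations and $f$ a colax morphism over retyping: a family of morphisms $f_V:g_!(PV)\to Q(g_!V)$ in $\mathsf{PO}^{T'}$ with $g_!(\eta^P_V);f_V=\eta^Q_{g_!V}$ and $g_!(\sigma^P(h));f_W=f_V;\sigma^Q(g_!h;f_W)$ for all $h:\Delta^TV\to PW$. Write $\hat f_V:P(V)_t\to Q(g_!V)_{g(t)}$ for the induced sortwise maps (inclusion into the coproduct followed by $f_V$); using $g_!(V^{*s})\cong (g_!V)^{*g(s)}$ these also act on derived modules. Classic arities and signatures. A classic arity of degree $n$ over $S$ is a syntactic expression $[([t_{1,1},\dots,t_{1,m_1}],t_1),\dots,([t_{k,1},\dots,t_{k,m_k}],t_k)]\to t_0$ with all $t_{i,j},t_i,t_0\in S(n)$. A typed signature $(S,\Sigma)$ is an algebraic signature $S$ with a family $\Sigma$ of classic arities over $S$ (each with its own degree). A representation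 of such an arity $\alpha$ in a relative $S$-monad $(T,R)$ is, for every $\vec u\in T^n$, a morphism of $R$-modules (codomain $\mathsf{PO}$) $\alpha^R_{\vec u}:\prod_{i=1}^k (R^{t_{i,1}(\vec u)\ldots t_{i,m_i}(\vec u)})_{t_i(\vec u)}\to R_{t_0(\vec u)}$ (empty product = terminal module $*$). A representation of $(S,\Sigma)$ is a relative $S$-monad with a representation of each arity of $\Sigma$. A morphism of representations $(T,P)\to(T',R)$ is a morphism $(g,f)$ of relative $S$-monads such that for each arity $\alpha$, each $\vec u\in T^n$, each context $V$ and each element $(x_1,\dots,x_k)$ of the domain, $\hat f(\alpha^P_{\vec u}(x_1,\dots,x_k))=\alpha^R_{g(\vec u)}(\hat f(x_1),\dots,\hat f(x_k))$. These form the category $\mathrm{Rep}^{\Delta}(S,\Sigma)$. -}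

module Defs where

open import Level using (Level) renaming (zero to lzero; suc to lsuc)
open import Data.Nat using (ℕ)
open import Data.Fin using (Fin)
open import Data.Vec as Vec using (Vec; []; _∷_; lookup)
open import Data.List as List using (List; []; _∷_)
open import Data.Product using (Σ; _×_; _,_; proj₁; proj₂)
open import Data.Sum using (_⊎_; inj₁; inj₂)
open import Data.Unit using (⊤; tt)
open import Relation.Binary.PropositionalEquality
  using (_≡_; refl; sym; trans; cong; cong₂; subst; subst₂)

record AlgSig : Set₁ where
  field
    J  : Set
    ar : J → ℕ
open AlgSig public

record AlgRep (S : AlgSig) : Set₁ where
  field
    Ty : Set
    op : (j : J S) → Vec Ty (ar S j) → Ty
open AlgRep public

record AlgRepHom {S : AlgSig} (A B : AlgRep S) : Set where
  field
    fun : Ty A → Ty B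
    hom : (j : J S) (us : Vec (Ty A) (ar S j)) →
          fun (op A j us) ≡ op B j (Vec.map fun us)
open AlgRepHom public

data TyExpr (S : AlgSig) (n : ℕ) : Set where
  var  : Fin n → TyExpr S n
  node : (j : J S) → Vec (TyExpr S n) (ar S j) → TyExpr S n

mutual
  ⟦_⟧ : {S : AlgSig} {n : ℕ} → TyExpr S n → (T : AlgRep S) → Vec (Ty T) n → Ty T
  ⟦ var i ⟧ T u = lookup u i
  ⟦ node j es ⟧ T u = op T j (⟦ es ⟧* T u)

  ⟦_⟧* : {S : AlgSig} {n k : ℕ} → Vec (TyExpr S n) k → (T : AlgRep S) → Vec (Ty T) n → Vec (Ty T) k
  ⟦ [] ⟧* T u = []
  ⟦ e ∷ es ⟧* T u = ⟦ e ⟧ T u ∷ ⟦ es ⟧* T u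

mutual
  eval-hom : {S : AlgSig} {A B : AlgRep S} (g : AlgRepHom A B) {n : ℕ}
             (e : TyExpr S n) (u : Vec (Ty A) n) →
             fun g (⟦ e ⟧ A u) ≡ ⟦ e ⟧ B (Vec.map (fun g) u)
  eval-hom g (var i) u = sym (lookup-map i u)
    where
    lookup-map : ∀ {A B : Set} {f : A → B} {n} (i : Fin n) (xs : Vec A n) →
                 lookup (Vec.map f xs) i ≡ f (lookup xs i)
    lookup-map Fin.zero (x ∷ xs) = refl
    lookup-map (Fin.suc i) (x ∷ xs) = lookup-map i xs
  eval-hom {B = B} g (node j es) u =
    trans (hom g j (⟦ es ⟧* _ u)) (cong (op B j) (eval-hom* g es u))

  eval-hom* : {S : AlgSig} {A B : AlgRep S} (g : AlgRepHom A B) {n k : ℕ}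
              (es : Vec (TyExpr S n) k) (u : Vec (Ty A) n) →
              Vec.map (fun g) (⟦ es ⟧* A u) ≡ ⟦ es ⟧* B (Vec.map (fun g) u)
  eval-hom* g [] u = refl
  eval-hom* g (e ∷ es) u = cong₂ _∷_ (eval-hom g e u) (eval-hom* g es u)

-- a premise ([t_{i,1},...,t_{i,m_i}], t_i)
Premise : AlgSig → ℕ → Set
Premise S n = List (TyExpr S n) × TyExpr S n

record ClassicArity (S : AlgSig) (n : ℕ) : Set where
  constructor _⇒_
  field
    premises : List (Premise S n)
    result   : TyExpr S n
open ClassicArity public

record TypedSig : Set₁ where
  field
    alg  : AlgSig
    Idx  : Set
    deg  : Idx → ℕ
    arity : (i : Idx) → ClassicArity alg (deg i)
open TypedSig public

record PO : Set₁ where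
  field
    ∣_∣  : Set
    _≤_  : ∣_∣ → ∣_∣ → Set
    ≤-refl  : ∀ {x} → x ≤ x
    ≤-trans : ∀ {x y z} → x ≤ y → y ≤ z → x ≤ z
open PO public

⊤PO : PO
⊤PO = record { ∣_∣ = ⊤ ; _≤_ = λ _ _ → ⊤ ; ≤-refl = tt ; ≤-trans = λ _ _ → tt }

_×PO_ : PO → PO → PO
A ×PO B = record
  { ∣_∣ = ∣ A ∣ × ∣ B ∣
  ; _≤_ = λ p q → (_≤_ A (proj₁ p) (proj₁ q)) × (_≤_ B (proj₂ p) (proj₂ q))
  ; ≤-refl = ≤-refl A , ≤-refl B
  ; ≤-trans = λ p q → ≤-trans A (proj₁ p) (proj₁ q) , ≤-trans B (proj₂ p) (proj₂ q)
  }

Ctx : Set → Set₁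
Ctx T = T → Set

-- D(s): one variable of sort s ; V^{*s} = V + D(s)
_*_ : {T : Set} → Ctx T → T → Ctx T
(V * s) t = V t ⊎ (s ≡ t)

_**_ : {T : Set} → Ctx T → List T → Ctx T
V ** [] = V
V ** (s ∷ ss) = (V * s) ** ss

_⇛_ : {T : Set} → Ctx T → Ctx T → Set
V ⇛ W = ∀ t → V t → W t

*-map : {T : Set} {V W : Ctx T} (s : T) → V ⇛ W → (V * s) ⇛ (W * s)
*-map s h t (inj₁ v) = inj₁ (h t v)
*-map s h t (inj₂ e) = inj₂ e

**-map : {T : Set} {V W : Ctx T} (ss : List T) → V ⇛ W → (V ** ss) ⇛ (W ** ss)
**-map [] h = h
**-map (s ∷ ss) h = **-map ss (*-map s h)

_! : {T T' : Set} → (T → T') → Ctx T → Ctx T'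
(g !) V t' = Σ _ (λ t → (g t ≡ t') × V t)

!-* : {T T' : Set} (g : T → T') {V : Ctx T} (s : T) →
      (g !) (V * s) ⇛ ((g !) V * g s)
!-* g s t' (t , p , inj₁ v) = inj₁ (t , p , v)
!-* g s t' (t , p , inj₂ e) = inj₂ (trans (cong g e) p)

!-** : {T T' : Set} (g : T → T') {V : Ctx T} (ss : List T) →
       (g !) (V ** ss) ⇛ ((g !) V ** List.map g ss)
!-** g [] = λ t x → x
!-** g {V} (s ∷ ss) t x = **-map (List.map g ss) (!-* g s) t (!-** g {V * s} ss t x)

-- Reduction monads over T (relative monads on Δ^T : Set^T → PO^T
-- with monotone substitution).  A morphism Δ^T X → P Y in PO^T is
-- exactly a sortwise function (the discrete order imposes nothing);
-- we write such Kleisli maps as sortwise functions.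

record ReductionMonad (T : Set) : Set₁ where
  field
    P : Ctx T → T → PO
  KHom : Ctx T → Ctx T → Set
  KHom X Y = ∀ t → X t → ∣ P Y t ∣
  field
    η : ∀ {X} → KHom X X
    σ : ∀ {X Y} → KHom X Y → ∀ t → ∣ P X t ∣ → ∣ P Y t ∣
    σ-mono : ∀ {X Y} (f : KHom X Y) t {x y : ∣ P X t ∣} →
             _≤_ (P X t) x y → _≤_ (P Y t) (σ f t x) (σ f t y)
    σ-monotone : ∀ {X Y} (f g : KHom X Y) →
                 (∀ t x → _≤_ (P Y t) (f t x) (g t x)) →
                 ∀ t p → _≤_ (P Y t) (σ f t p) (σ g t p)
    σ-cong : ∀ {X Y} (f g : KHom X Y) → (∀ t x → f t x ≡ g t x) →
             ∀ t p → σ f t p ≡ σ g t p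
    η-σ : ∀ {X Y} (f : KHom X Y) t x → σ f t (η t x) ≡ f t x
    σ-η : ∀ {X} t (p : ∣ P X t ∣) → σ (η {X}) t p ≡ p
    σ-σ : ∀ {X Y Z} (f : KHom X Y) (g : KHom Y Z) t p →
          σ g t (σ f t p) ≡ σ (λ s x → σ g s (f s x)) t p

  map : ∀ {X Y} → X ⇛ Y → ∀ t → ∣ P X t ∣ → ∣ P Y t ∣
  map h = σ (λ t x → η t (h t x))

  shift : ∀ {V W} (s : T) → KHom V W → KHom (V * s) (W * s)
  shift s f t (inj₁ v) = map (λ _ → inj₁) t (f t v)
  shift s f t (inj₂ e) = η t (inj₂ e)

  shift* : ∀ {V W} (ss : List T) → KHom V W → KHom (V ** ss) (W ** ss)
  shift* [] f = f
  shift* (s ∷ ss) f = shift* ss (shift s f)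
open ReductionMonad public

record RelSMonad (S : AlgSig) : Set₂ where
  field
    rep   : AlgRep S
    monad : ReductionMonad (Ty rep)
open RelSMonad public

-- a colax morphism over retyping along g, given by its components
-- on the summands of the coproduct g_!(PV): fhat : P(V)_t → Q(g_!V)_{g t}
record ColaxMor {T T' : Set} (g : T → T')
                (P : ReductionMonad T) (Q : ReductionMonad T') : Set₁ where
  field
    fhat : ∀ {V : Ctx T} t → ∣ ReductionMonad.P P V t ∣ → ∣ ReductionMonad.P Q ((g !) V) (g t) ∣
    fhat-mono : ∀ {V : Ctx T} t {x y} → _≤_ (ReductionMonad.P P V t) x y →
                _≤_ (ReductionMonad.P Q ((g !) V) (g t)) (fhat t x) (fhat t y)
    fhat-η : ∀ {V : Ctx T} t (v : V t) →
             fhat {V} t (η P {V} t v) ≡ η Q {(g !) V} (g t) (t , refl , v)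
    -- g_!(σ^P(h)) ; f_W = f_V ; σ^Q(g_!h ; f_W)
    fhat-σ : ∀ {V W} (h : KHom P V W) t (x : ∣ ReductionMonad.P P V t ∣) →
             fhat t (σ P h t x) ≡
             σ Q (λ t' y → subst (λ τ → ∣ ReductionMonad.P Q ((g !) W) τ ∣)
                                  (proj₁ (proj₂ y))
                                  (fhat (proj₁ y) (h (proj₁ y) (proj₂ (proj₂ y)))))
                 (g t) (fhat t x)
open ColaxMor public

record RelSMonadMor {S : AlgSig} (A B : RelSMonad S) : Set₁ where
  field
    g : AlgRepHom (rep A) (rep B)
    f : ColaxMor (fun g) (monad A) (monad B)
open RelSMonadMor public

module _ {S : AlgSig} {n : ℕ} (T : AlgRep S) (R : ReductionMonad (Ty T))
         (u : Vec (Ty T) n) where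

  PremPO : Premise S n → Ctx (Ty T) → PO
  PremPO (ss , t) V = ReductionMonad.P R (V ** List.map (λ e → ⟦ e ⟧ T u) ss) (⟦ t ⟧ T u)

  ArgsPO : List (Premise S n) → Ctx (Ty T) → PO
  ArgsPO [] V = ⊤PO
  ArgsPO (p ∷ ps) V = PremPO p V ×PO ArgsPO ps V

  substArgs : (ps : List (Premise S n)) {V W : Ctx (Ty T)} →
              KHom R V W → ∣ ArgsPO ps V ∣ → ∣ ArgsPO ps W ∣
  substArgs [] h _ = tt
  substArgs ((ss , t) ∷ ps) h (x , xs) =
    σ R (shift* R (List.map (λ e → ⟦ e ⟧ T u) ss) h) (⟦ t ⟧ T u) x , substArgs ps h xs

  -- a morphism of R-modules  ∏ (R^{...})_{t_i(u)} → R_{t_0(u)}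
  record AritySlot (α : ClassicArity S n) : Set₁ where
    field
      act : ∀ {V} → ∣ ArgsPO (premises α) V ∣ → ∣ ReductionMonad.P R V (⟦ result α ⟧ T u) ∣
      act-mono : ∀ {V} {xs ys} → _≤_ (ArgsPO (premises α) V) xs ys →
                 _≤_ (ReductionMonad.P R V (⟦ result α ⟧ T u)) (act xs) (act ys)
      act-nat : ∀ {V W} (h : KHom R V W) (xs : ∣ ArgsPO (premises α) V ∣) →
                act (substArgs (premises α) h xs) ≡ σ R h (⟦ result α ⟧ T u) (act xs)
  open AritySlot public

record Rep (Σ : TypedSig) : Set₂ where
  field
    base : RelSMonad (alg Σ)
    arep : (i : Idx Σ) (u : Vec (Ty (rep base)) (deg Σ i)) →
           AritySlot (rep base) (monad base) u (arity Σ i)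
open Rep public

-- action of f-hat on the arguments, transported along the canonical isos
module _ {S : AlgSig} {A B : RelSMonad S} (m : RelSMonadMor A B) {n : ℕ}
         (u : Vec (Ty (rep A)) n) where
  private
    gf = fun (g m)
    u' = Vec.map gf u
    Q  = monad B

  evalL-hom : (ss : List (TyExpr S n)) →
              List.map gf (List.map (λ e → ⟦ e ⟧ (rep A) u) ss) ≡
              List.map (λ e → ⟦ e ⟧ (rep B) u') ss
  evalL-hom [] = refl
  evalL-hom (e ∷ ss) = cong₂ _∷_ (eval-hom (g m) e u) (evalL-hom ss)

  fhatArgs : (ps : List (Premise S n)) {V : Ctx (Ty (rep A))} →
             ∣ ArgsPO (rep A) (monad A) u ps V ∣ →
             ∣ ArgsPO (rep B) Q u' ps ((gf !) V) ∣
  fhatArgs [] _ = tt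
  fhatArgs ((ss , t) ∷ ps) {V} (x , xs) =
    subst₂ (λ ss' τ → ∣ ReductionMonad.P Q (((gf !) V) ** ss') τ ∣)
           (evalL-hom ss) (eval-hom (g m) t u)
           (map Q (!-** gf (List.map (λ e → ⟦ e ⟧ (rep A) u) ss)) _
                (fhat (f m) _ x))
    , fhatArgs ps xs

record RepMor {Σ : TypedSig} (A B : Rep Σ) : Set₁ where
  field
    mor : RelSMonadMor (base A) (base B)
    commutes : (i : Idx Σ) (u : Vec (Ty (rep (base A))) (deg Σ i))
               {V : Ctx (Ty (rep (base A)))}
               (xs : ∣ ArgsPO (rep (base A)) (monad (base A)) u (premises (arity Σ i)) V ∣) →
               subst (λ τ → ∣ ReductionMonad.P (monad (base B)) ((fun (g mor) !) V) τ ∣)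
                     (eval-hom (g mor) (result (arity Σ i)) u)
                     (fhat (f mor) _ (act (arep A i u) xs))
               ≡ act (arep B i (Vec.map (fun (g mor)) u)) (fhatArgs mor u (premises (arity Σ i)) xs)
open RepMor public

-- equality of morphisms: g = g' and f = f' (the latter compared along the
-- canonical identification g_!V ≅ g'_!V induced by g = g')
record _≈Mor_ {Σ : TypedSig} {A B : Rep Σ} (m m' : RepMor A B) : Set₁ where
  private
    g₁ = fun (g (mor m))
    g₂ = fun (g (mor m'))
  field
    g-eq : ∀ t → g₁ t ≡ g₂ t
    f-eq : ∀ {V : Ctx (Ty (rep (base A)))} t (x : ∣ ReductionMonad.P (monad (base A)) V t ∣) →
           subst (λ τ → ∣ ReductionMonad.P (monad (base B)) ((g₂ !) V) τ ∣) (g-eq t)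
                 (map (monad (base B))
                      (λ t' y → proj₁ y , trans (sym (g-eq (proj₁ y))) (proj₁ (proj₂ y)) , proj₂ (proj₂ y))
                      (g₁ t) (fhat (f (mor m)) t x))
           ≡ fhat (f (mor m')) t x

IsInitial : {Σ : TypedSig} → Rep Σ → Set₂
IsInitial {Σ} I = (R : Rep Σ) → RepMor I R × ((m m' : RepMor I R) → m ≈Mor m')

HasInitial : TypedSig → Set₂
HasInitial Σ = Data.Product.Σ (Rep Σ) IsInitial

module Submission where

-- The initial representation is syntax. Its types are the closed type expressions, the initial
-- S-representation; its terms are the well-typed terms with one constructor per arity of Σ and
-- instance of its type variables, a relative monad under capture-avoiding substitution, and each
-- arity is represented by its constructor. Into any other representation R, types are mapped by
-- evaluation and terms by structural recursion (variables to units, constructors through the arity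
-- representations of R); compatibility with substitution holds by induction on terms because arity
-- representations are module morphisms. Conversely any morphism out of the syntax has the same
-- type map, by initiality of the closed types, and the same term map, by induction on terms, since
-- it preserves units and commutes with the arities.

open import Defs
open import Data.Nat using (ℕ)
open import Data.Vec as Vec using (Vec; []; _∷_)
open import Data.List as List using (List; []; _∷_)
open import Data.List.Relation.Binary.Pointwise as Pointwise using (Pointwise; []; _∷_; Pointwise-≡⇒≡)
open import Data.Product using (_×_; _,_)
open import Data.Sum using (inj₁; inj₂)
open import Data.Unit using (tt)
open import Axiom.UniquenessOfIdentityProofs.WithK using (uip)
open import Relation.Binary.PropositionalEquality
  using (_≡_; refl; sym; trans; cong; cong₂; subst; subst₂;
         subst-subst; subst-subst-sym; subst-sym-subst; module ≡-Reasoning)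

infix 4 _≐_
_≐_ : {A : Set} {X Y : A → Set} (f g : ∀ a → X a → Y a) → Set
f ≐ g = ∀ a x → f a x ≡ g a x

module _ {A B : Set} (F : A → B → Set) where

  subst₂-subst₂ : ∀ {a₁ a₂ a₃ b₁ b₂ b₃} (p : a₁ ≡ a₂) (q : b₁ ≡ b₂) (p′ : a₂ ≡ a₃) (q′ : b₂ ≡ b₃) z →
                  subst₂ F p′ q′ (subst₂ F p q z) ≡ subst₂ F (trans p p′) (trans q q′) z
  subst₂-subst₂ refl refl p′ q′ z = refl

  subst₂-irrelevant : ∀ {a₁ a₂ b₁ b₂} (p p′ : a₁ ≡ a₂) (q q′ : b₁ ≡ b₂) z →
                      subst₂ F p q z ≡ subst₂ F p′ q′ z
  subst₂-irrelevant p p′ q q′ z = cong₂ (λ p q → subst₂ F p q z) (uip p p′) (uip q q′)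

  subst₂-subst₂-irrelevant : ∀ {a₁ a₂ a₂′ a₃ b₁ b₂ b₂′ b₃}
                             (p : a₁ ≡ a₂) (q : b₁ ≡ b₂) (p′ : a₂ ≡ a₃) (q′ : b₂ ≡ b₃)
                             (r : a₁ ≡ a₂′) (s : b₁ ≡ b₂′) (r′ : a₂′ ≡ a₃) (s′ : b₂′ ≡ b₃) z →
                             subst₂ F p′ q′ (subst₂ F p q z) ≡ subst₂ F r′ s′ (subst₂ F r s z)
  subst₂-subst₂-irrelevant p q p′ q′ r s r′ s′ z =
    trans (subst₂-subst₂ p q p′ q′ z)
          (trans (subst₂-irrelevant _ _ _ _ z) (sym (subst₂-subst₂ r s r′ s′ z)))

  subst-as-subst₂ : ∀ {a b₁ b₂} (q : b₁ ≡ b₂) z → subst (F a) q z ≡ subst₂ F refl q z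
  subst-as-subst₂ refl z = refl

  subst-∘-as-subst₂ : ∀ {C : Set} (f : C → A) (g : C → B) {c₁ c₂} (q : c₁ ≡ c₂) z →
                      subst (λ c → F (f c) (g c)) q z ≡ subst₂ F (cong f q) (cong g q) z
  subst-∘-as-subst₂ f g refl z = refl

subst-× : ∀ {A : Set} (F G : A → Set) {a b} (q : a ≡ b) x y →
          subst (λ c → F c × G c) q (x , y) ≡ (subst F q x , subst G q y)
subst-× F G refl x y = refl

module _ {T : Set} where

  *-map-cong : ∀ {V W : Ctx T} (s : T) {ρ ρ′ : V ⇛ W} → ρ ≐ ρ′ → *-map s ρ ≐ *-map s ρ′
  *-map-cong s e t (inj₁ v) = cong inj₁ (e t v)
  *-map-cong s e t (inj₂ q) = refl

  **-map-cong : ∀ {V W : Ctx T} (L : List T) {ρ ρ′ : V ⇛ W} → ρ ≐ ρ′ → **-map L ρ ≐ **-map L ρ′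
  **-map-cong []      e = e
  **-map-cong (s ∷ L) e = **-map-cong L (*-map-cong s e)

  **-map-∘ : ∀ {U V W : Ctx T} (L : List T) (ρ : U ⇛ V) (ρ′ : V ⇛ W) →
             (λ t x → **-map L ρ′ t (**-map L ρ t x)) ≐ **-map L (λ t x → ρ′ t (ρ t x))
  **-map-∘ []      ρ ρ′ t x = refl
  **-map-∘ (s ∷ L) ρ ρ′ t x =
    trans (**-map-∘ L (*-map s ρ) (*-map s ρ′) t x) (**-map-cong L *-map-∘ t x)
    where
    *-map-∘ : (λ t x → *-map s ρ′ t (*-map s ρ t x)) ≐ *-map s (λ t x → ρ′ t (ρ t x))
    *-map-∘ t (inj₁ v) = refl
    *-map-∘ t (inj₂ q) = refl

  **-map-square : ∀ {U V V′ W : Ctx T} (L : List T)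
                  {ρ₁ : U ⇛ V} {ρ₂ : V ⇛ W} {ρ₃ : U ⇛ V′} {ρ₄ : V′ ⇛ W} →
                  (λ t x → ρ₂ t (ρ₁ t x)) ≐ (λ t x → ρ₄ t (ρ₃ t x)) →
                  (λ t x → **-map L ρ₂ t (**-map L ρ₁ t x)) ≐ (λ t x → **-map L ρ₄ t (**-map L ρ₃ t x))
  **-map-square L {ρ₁} {ρ₂} {ρ₃} {ρ₄} e t x =
    trans (**-map-∘ L ρ₁ ρ₂ t x) (trans (**-map-cong L e t x) (sym (**-map-∘ L ρ₃ ρ₄ t x)))

  **-map-id : ∀ {V : Ctx T} (L : List T) → **-map {V = V} L (λ t x → x) ≐ (λ t x → x)
  **-map-id []      t x = refl
  **-map-id {V} (s ∷ L) t x = trans (**-map-cong L *-map-id t x) (**-map-id L t x)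
    where
    *-map-id : *-map {V = V} s (λ t x → x) ≐ (λ t x → x)
    *-map-id t (inj₁ v) = refl
    *-map-id t (inj₂ q) = refl

  *-cast : ∀ {C : Ctx T} {s s′} → s ≡ s′ → (C * s) ⇛ (C * s′)
  *-cast e t (inj₁ c) = inj₁ c
  *-cast e t (inj₂ q) = inj₂ (trans (sym e) q)

  **-cast : ∀ {C : Ctx T} {L L′} → Pointwise _≡_ L L′ → (C ** L) ⇛ (C ** L′)
  **-cast []                       t x = x
  **-cast {L = _ ∷ L} (e ∷ es) t x = **-cast es t (**-map L (*-cast e) t x)

  **-cast-natural : ∀ {C D : Ctx T} {L L′} (es : Pointwise _≡_ L L′) (ρ : C ⇛ D) →
                    (λ t x → **-cast es t (**-map L ρ t x)) ≐ (λ t x → **-map L′ ρ t (**-cast es t x))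
  **-cast-natural []                        ρ t x = refl
  **-cast-natural {C} {D} {L = s ∷ L} (e ∷ es) ρ t x =
    trans (cong (**-cast es t) (**-map-square L *-cast-natural t x))
          (**-cast-natural es (*-map _ ρ) t _)
    where
    *-cast-natural : (λ t x → *-cast {D} e t (*-map s ρ t x)) ≐ (λ t x → *-map _ ρ t (*-cast {C} e t x))
    *-cast-natural t (inj₁ c) = refl
    *-cast-natural t (inj₂ q) = refl

  **-cast-refl : ∀ {C : Ctx T} (L : List T) → **-cast {C} (Pointwise.refl refl {L}) ≐ (λ t x → x)
  **-cast-refl []      t x = refl
  **-cast-refl {C} (s ∷ L) t x =
    trans (cong (**-cast (Pointwise.refl refl {L}) t) (trans (**-map-cong L *-cast-refl t x) (**-map-id L t x)))
          (**-cast-refl L t x)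
    where
    *-cast-refl : *-cast {C} (refl {x = s}) ≐ (λ t x → x)
    *-cast-refl t (inj₁ c) = refl
    *-cast-refl t (inj₂ q) = refl

module _ {T T′ : Set} (g : T → T′) where

  !-map : {V W : Ctx T} → V ⇛ W → (g !) V ⇛ (g !) W
  !-map ρ t′ (t , p , v) = t , p , ρ t v

  !-**-natural : {V W : Ctx T} (L : List T) (ρ : V ⇛ W) →
                 (λ t′ z → !-** g L t′ (!-map (**-map L ρ) t′ z)) ≐
                 (λ t′ z → **-map (List.map g L) (!-map ρ) t′ (!-** g L t′ z))
  !-**-natural []      ρ t′ z = refl
  !-**-natural {V} {W} (s ∷ L) ρ t′ z =
    trans (cong (**-map (List.map g L) (!-* g s) t′) (!-**-natural L (*-map s ρ) t′ z))
          (**-map-square (List.map g L) !-*-natural t′ _)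
    where
    !-*-natural : (λ t x → !-* g {W} s t (!-map (*-map s ρ) t x)) ≐
                  (λ t x → *-map (g s) (!-map ρ) t (!-* g {V} s t x))
    !-*-natural t (t₀ , p , inj₁ v) = refl
    !-*-natural t (t₀ , p , inj₂ e) = refl

module ReductionMonadProperties {T : Set} (R : ReductionMonad T) where

  El : Ctx T → T → Set
  El V t = ∣ P R V t ∣

  El** : Ctx T → List T → T → Set
  El** C L t = El (C ** L) t

  map-cong : ∀ {X Y} {ρ ρ′ : X ⇛ Y} → ρ ≐ ρ′ → map R ρ ≐ map R ρ′
  map-cong e = σ-cong R _ _ (λ t x → cong (η R t) (e t x))

  map-η : ∀ {X Y} (ρ : X ⇛ Y) t x → map R ρ t (η R t x) ≡ η R t (ρ t x)
  map-η ρ = η-σ R _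

  σ-map : ∀ {X Y Z} (ρ : X ⇛ Y) (k : KHom R Y Z) →
          (λ t p → σ R k t (map R ρ t p)) ≐ σ R (λ t x → k t (ρ t x))
  σ-map ρ k t p = trans (σ-σ R _ k t p) (σ-cong R _ _ (λ t x → η-σ R k t (ρ t x)) t p)

  map-σ : ∀ {X Y Z} (k : KHom R X Y) (ρ : Y ⇛ Z) →
          (λ t p → map R ρ t (σ R k t p)) ≐ σ R (λ t x → map R ρ t (k t x))
  map-σ k ρ = σ-σ R k _

  map-∘ : ∀ {X Y Z} (ρ : X ⇛ Y) (ρ′ : Y ⇛ Z) →
          (λ t p → map R ρ′ t (map R ρ t p)) ≐ map R (λ t x → ρ′ t (ρ t x))
  map-∘ ρ ρ′ = σ-map ρ _

  map-id : ∀ {X} → map R {X} (λ t x → x) ≐ (λ t p → p)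
  map-id = σ-η R

  σ-subst : ∀ {X Y} (k : KHom R X Y) {t t′} (e : t ≡ t′) (p : El X t) →
            σ R k t′ (subst (El X) e p) ≡ subst (El Y) e (σ R k t p)
  σ-subst k refl p = refl

  σ-shift*-subst₂ : ∀ {X Y} (k : KHom R X Y) {L L′ t t′} (e : L ≡ L′) (e′ : t ≡ t′) p →
                    σ R (shift* R L′ k) t′ (subst₂ (El** X) e e′ p) ≡
                    subst₂ (El** Y) e e′ (σ R (shift* R L k) t p)
  σ-shift*-subst₂ k refl refl p = refl

  shift*-cong : ∀ {V W} (L : List T) {f f′ : KHom R V W} → f ≐ f′ → shift* R L f ≐ shift* R L f′
  shift*-cong []      e = e
  shift*-cong (s ∷ L) e = shift*-cong L shift-cong
    where
    shift-cong : shift R s _ ≐ shift R s _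
    shift-cong t (inj₁ v) = cong (map R (λ _ → inj₁) t) (e t v)
    shift-cong t (inj₂ q) = refl

  shift*-η : ∀ {V W} (L : List T) (ρ : V ⇛ W) →
             shift* R L (λ t v → η R t (ρ t v)) ≐ (λ t x → η R t (**-map L ρ t x))
  shift*-η []      ρ t x = refl
  shift*-η (s ∷ L) ρ t x = trans (shift*-cong L shift-η t x) (shift*-η L (*-map s ρ) t x)
    where
    shift-η : shift R s (λ t v → η R t (ρ t v)) ≐ (λ t x → η R t (*-map s ρ t x))
    shift-η t (inj₁ v) = map-η _ t (ρ t v)
    shift-η t (inj₂ q) = refl

  shift*-natural : ∀ (L : List T) {A B A′ B′} (ρA : A ⇛ A′) (ρB : B ⇛ B′)
                   (k : KHom R A B) (k′ : KHom R A′ B′) →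
                   (λ t v → map R ρB t (k t v)) ≐ (λ t v → k′ t (ρA t v)) →
                   (λ t x → map R (**-map L ρB) t (shift* R L k t x)) ≐
                   (λ t x → shift* R L k′ t (**-map L ρA t x))
  shift*-natural []      ρA ρB k k′ e = e
  shift*-natural (s ∷ L) ρA ρB k k′ e =
    shift*-natural L (*-map s ρA) (*-map s ρB) (shift R s k) (shift R s k′) shift-natural
    where
    shift-natural : (λ t v → map R (*-map s ρB) t (shift R s k t v)) ≐
                    (λ t v → shift R s k′ t (*-map s ρA t v))
    shift-natural t (inj₁ v) =
      trans (map-∘ _ _ t (k t v))
            (trans (sym (map-∘ ρB (λ _ → inj₁) t (k t v))) (cong (map R (λ _ → inj₁) t) (e t v)))
    shift-natural t (inj₂ q) = map-η _ t (inj₂ q)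

  subst-**-as-map : ∀ {C : Ctx T} {L L′} (e : L ≡ L′) (es : Pointwise _≡_ L L′) {t} (p : El (C ** L) t) →
                    subst₂ (El** C) e refl p ≡ map R (**-cast es) t p
  subst-**-as-map {C} {L} refl es p =
    trans (sym (map-id _ p))
          (map-cong (λ t x → trans (sym (**-cast-refl L t x))
                                   (cong (λ es → **-cast es t x) (Pointwise.irrelevant uip (Pointwise.refl refl) es))) _ p)

module Syntax (Sg : TypedSig) where

  S : AlgSig
  S = alg Sg

  Ty₀ : Set
  Ty₀ = TyExpr S 0

  closedTypes : AlgRep S
  closedTypes = record { Ty = Ty₀ ; op = node }

  binderTypes : ∀ {n} → Vec Ty₀ n → List (TyExpr S n) → List Ty₀
  binderTypes u = List.map (λ e → ⟦ e ⟧ closedTypes u)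

  mutual
    data Tm (V : Ctx Ty₀) : Ty₀ → Set where
      var : ∀ {t} → V t → Tm V t
      con : (i : Idx Sg) (u : Vec Ty₀ (deg Sg i)) →
            Args V u (premises (arity Sg i)) → Tm V (⟦ result (arity Sg i) ⟧ closedTypes u)

    data Args (V : Ctx Ty₀) {n : ℕ} (u : Vec Ty₀ n) : List (Premise S n) → Set where
      []  : Args V u []
      _∷_ : ∀ {ss t ps} → Tm (V ** binderTypes u ss) (⟦ t ⟧ closedTypes u) →
            Args V u ps → Args V u ((ss , t) ∷ ps)

  mutual
    ren : ∀ {V W} → V ⇛ W → ∀ {t} → Tm V t → Tm W t
    ren ρ (var v)      = var (ρ _ v)
    ren ρ (con i u as) = con i u (renArgs ρ as)

    renArgs : ∀ {V W n} {u : Vec Ty₀ n} {ps} → V ⇛ W → Args V u ps → Args W u ps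
    renArgs ρ []                                = []
    renArgs {u = u} ρ (_∷_ {ss = ss} a as) = ren (**-map (binderTypes u ss) ρ) a ∷ renArgs ρ as

  Sub : Ctx Ty₀ → Ctx Ty₀ → Set
  Sub V W = ∀ t → V t → Tm W t

  lift : ∀ {V W} (s : Ty₀) → Sub V W → Sub (V * s) (W * s)
  lift s f t (inj₁ v) = ren (λ _ → inj₁) (f t v)
  lift s f t (inj₂ q) = var (inj₂ q)

  lift* : ∀ {V W} (L : List Ty₀) → Sub V W → Sub (V ** L) (W ** L)
  lift* []      f = f
  lift* (s ∷ L) f = lift* L (lift s f)

  mutual
    sub : ∀ {V W} → Sub V W → ∀ {t} → Tm V t → Tm W t
    sub f (var v)      = f _ v
    sub f (con i u as) = con i u (subArgs f as)

    subArgs : ∀ {V W n} {u : Vec Ty₀ n} {ps} → Sub V W → Args V u ps → Args W u ps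
    subArgs f []                                = []
    subArgs {u = u} f (_∷_ {ss = ss} a as) = sub (lift* (binderTypes u ss) f) a ∷ subArgs f as

  mutual
    ren-cong : ∀ {V W} {ρ ρ′ : V ⇛ W} → ρ ≐ ρ′ → ∀ {t} (x : Tm V t) → ren ρ x ≡ ren ρ′ x
    ren-cong e (var v)      = cong var (e _ v)
    ren-cong e (con i u as) = cong (con i u) (renArgs-cong e as)

    renArgs-cong : ∀ {V W n} {u : Vec Ty₀ n} {ps} {ρ ρ′ : V ⇛ W} → ρ ≐ ρ′ →
                   (as : Args V u ps) → renArgs ρ as ≡ renArgs ρ′ as
    renArgs-cong e []                                = refl
    renArgs-cong {u = u} e (_∷_ {ss = ss} a as) =
      cong₂ _∷_ (ren-cong (**-map-cong (binderTypes u ss) e) a) (renArgs-cong e as)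

  mutual
    ren-∘ : ∀ {U V W} (ρ : U ⇛ V) (ρ′ : V ⇛ W) → ∀ {t} (x : Tm U t) →
            ren ρ′ (ren ρ x) ≡ ren (λ t x → ρ′ t (ρ t x)) x
    ren-∘ ρ ρ′ (var v)      = refl
    ren-∘ ρ ρ′ (con i u as) = cong (con i u) (renArgs-∘ ρ ρ′ as)

    renArgs-∘ : ∀ {U V W n} {u : Vec Ty₀ n} {ps} (ρ : U ⇛ V) (ρ′ : V ⇛ W) (as : Args U u ps) →
                renArgs ρ′ (renArgs ρ as) ≡ renArgs (λ t x → ρ′ t (ρ t x)) as
    renArgs-∘ ρ ρ′ []                                = refl
    renArgs-∘ {u = u} ρ ρ′ (_∷_ {ss = ss} a as) =
      cong₂ _∷_ (trans (ren-∘ _ _ a) (ren-cong (**-map-∘ (binderTypes u ss) ρ ρ′) a)) (renArgs-∘ ρ ρ′ as)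

  lift*-cong : ∀ {V W} (L : List Ty₀) {f f′ : Sub V W} → f ≐ f′ → lift* L f ≐ lift* L f′
  lift*-cong []      e = e
  lift*-cong (s ∷ L) e = lift*-cong L lift-cong
    where
    lift-cong : lift s _ ≐ lift s _
    lift-cong t (inj₁ v) = cong (ren (λ _ → inj₁)) (e t v)
    lift-cong t (inj₂ q) = refl

  mutual
    sub-cong : ∀ {V W} {f f′ : Sub V W} → f ≐ f′ → ∀ {t} (x : Tm V t) → sub f x ≡ sub f′ x
    sub-cong e (var v)      = e _ v
    sub-cong e (con i u as) = cong (con i u) (subArgs-cong e as)

    subArgs-cong : ∀ {V W n} {u : Vec Ty₀ n} {ps} {f f′ : Sub V W} → f ≐ f′ →
                   (as : Args V u ps) → subArgs f as ≡ subArgs f′ as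
    subArgs-cong e []                                = refl
    subArgs-cong {u = u} e (_∷_ {ss = ss} a as) =
      cong₂ _∷_ (sub-cong (lift*-cong (binderTypes u ss) e) a) (subArgs-cong e as)

  lift*-ren : ∀ {U V W} (L : List Ty₀) (ρ : U ⇛ V) (f : Sub V W) →
              (λ t v → lift* L f t (**-map L ρ t v)) ≐ lift* L (λ t v → f t (ρ t v))
  lift*-ren []      ρ f t v = refl
  lift*-ren (s ∷ L) ρ f t v = trans (lift*-ren L (*-map s ρ) (lift s f) t v) (lift*-cong L lift-ren t v)
    where
    lift-ren : (λ t v → lift s f t (*-map s ρ t v)) ≐ lift s (λ t v → f t (ρ t v))
    lift-ren t (inj₁ v) = refl
    lift-ren t (inj₂ q) = refl

  mutual
    sub-ren : ∀ {U V W} (ρ : U ⇛ V) (f : Sub V W) → ∀ {t} (x : Tm U t) →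
              sub f (ren ρ x) ≡ sub (λ t v → f t (ρ t v)) x
    sub-ren ρ f (var v)      = refl
    sub-ren ρ f (con i u as) = cong (con i u) (subArgs-ren ρ f as)

    subArgs-ren : ∀ {U V W n} {u : Vec Ty₀ n} {ps} (ρ : U ⇛ V) (f : Sub V W) (as : Args U u ps) →
                  subArgs f (renArgs ρ as) ≡ subArgs (λ t v → f t (ρ t v)) as
    subArgs-ren ρ f []                                = refl
    subArgs-ren {u = u} ρ f (_∷_ {ss = ss} a as) =
      cong₂ _∷_ (trans (sub-ren _ _ a) (sub-cong (lift*-ren (binderTypes u ss) ρ f) a)) (subArgs-ren ρ f as)

  ren-lift* : ∀ {U V W} (L : List Ty₀) (f : Sub U V) (ρ : V ⇛ W) →
              (λ t v → ren (**-map L ρ) (lift* L f t v)) ≐ lift* L (λ t v → ren ρ (f t v))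
  ren-lift* []      f ρ t v = refl
  ren-lift* (s ∷ L) f ρ t v = trans (ren-lift* L (lift s f) (*-map s ρ) t v) (lift*-cong L ren-lift t v)
    where
    ren-lift : (λ t v → ren (*-map s ρ) (lift s f t v)) ≐ lift s (λ t v → ren ρ (f t v))
    ren-lift t (inj₁ v) = trans (ren-∘ _ _ (f t v)) (sym (ren-∘ _ _ (f t v)))
    ren-lift t (inj₂ q) = refl

  mutual
    ren-sub : ∀ {U V W} (f : Sub U V) (ρ : V ⇛ W) → ∀ {t} (x : Tm U t) →
              ren ρ (sub f x) ≡ sub (λ t v → ren ρ (f t v)) x
    ren-sub f ρ (var v)      = refl
    ren-sub f ρ (con i u as) = cong (con i u) (renArgs-sub f ρ as)

    renArgs-sub : ∀ {U V W n} {u : Vec Ty₀ n} {ps} (f : Sub U V) (ρ : V ⇛ W) (as : Args U u ps) →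
                  renArgs ρ (subArgs f as) ≡ subArgs (λ t v → ren ρ (f t v)) as
    renArgs-sub f ρ []                                = refl
    renArgs-sub {u = u} f ρ (_∷_ {ss = ss} a as) =
      cong₂ _∷_ (trans (ren-sub _ _ a) (sub-cong (ren-lift* (binderTypes u ss) f ρ) a)) (renArgs-sub f ρ as)

  lift*-sub : ∀ {U V W} (L : List Ty₀) (f : Sub U V) (g : Sub V W) →
              (λ t v → sub (lift* L g) (lift* L f t v)) ≐ lift* L (λ t v → sub g (f t v))
  lift*-sub []      f g t v = refl
  lift*-sub (s ∷ L) f g t v = trans (lift*-sub L (lift s f) (lift s g) t v) (lift*-cong L lift-sub t v)
    where
    lift-sub : (λ t v → sub (lift s g) (lift s f t v)) ≐ lift s (λ t v → sub g (f t v))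
    lift-sub t (inj₁ v) = trans (sub-ren _ _ (f t v)) (sym (ren-sub _ _ (f t v)))
    lift-sub t (inj₂ q) = refl

  mutual
    sub-∘ : ∀ {U V W} (f : Sub U V) (g : Sub V W) → ∀ {t} (x : Tm U t) →
            sub g (sub f x) ≡ sub (λ t v → sub g (f t v)) x
    sub-∘ f g (var v)      = refl
    sub-∘ f g (con i u as) = cong (con i u) (subArgs-∘ f g as)

    subArgs-∘ : ∀ {U V W n} {u : Vec Ty₀ n} {ps} (f : Sub U V) (g : Sub V W) (as : Args U u ps) →
                subArgs g (subArgs f as) ≡ subArgs (λ t v → sub g (f t v)) as
    subArgs-∘ f g []                                = refl
    subArgs-∘ {u = u} f g (_∷_ {ss = ss} a as) =
      cong₂ _∷_ (trans (sub-∘ _ _ a) (sub-cong (lift*-sub (binderTypes u ss) f g) a)) (subArgs-∘ f g as)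

  lift*-var : ∀ {V W} (L : List Ty₀) (ρ : V ⇛ W) →
              lift* L (λ t v → var (ρ t v)) ≐ (λ t v → var (**-map L ρ t v))
  lift*-var []      ρ t v = refl
  lift*-var (s ∷ L) ρ t v = trans (lift*-cong L lift-var t v) (lift*-var L (*-map s ρ) t v)
    where
    lift-var : lift s (λ t v → var (ρ t v)) ≐ (λ t v → var (*-map s ρ t v))
    lift-var t (inj₁ v) = refl
    lift-var t (inj₂ q) = refl

  mutual
    sub-var : ∀ {V W} (ρ : V ⇛ W) → ∀ {t} (x : Tm V t) → sub (λ t v → var (ρ t v)) x ≡ ren ρ x
    sub-var ρ (var v)      = refl
    sub-var ρ (con i u as) = cong (con i u) (subArgs-var ρ as)

    subArgs-var : ∀ {V W n} {u : Vec Ty₀ n} {ps} (ρ : V ⇛ W) (as : Args V u ps) →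
                  subArgs (λ t v → var (ρ t v)) as ≡ renArgs ρ as
    subArgs-var ρ []                                = refl
    subArgs-var {u = u} ρ (_∷_ {ss = ss} a as) =
      cong₂ _∷_ (trans (sub-cong (lift*-var (binderTypes u ss) ρ) a) (sub-var _ a)) (subArgs-var ρ as)

  mutual
    ren-id : ∀ {V t} (x : Tm V t) → ren (λ t v → v) x ≡ x
    ren-id (var v)      = refl
    ren-id (con i u as) = cong (con i u) (renArgs-id as)

    renArgs-id : ∀ {V n} {u : Vec Ty₀ n} {ps} (as : Args V u ps) → renArgs (λ t v → v) as ≡ as
    renArgs-id []                                = refl
    renArgs-id {u = u} (_∷_ {ss = ss} a as) =
      cong₂ _∷_ (trans (ren-cong (**-map-id (binderTypes u ss)) a) (ren-id a)) (renArgs-id as)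

  sub-id : ∀ {V t} (x : Tm V t) → sub (λ t v → var v) x ≡ x
  sub-id x = trans (sub-var (λ t v → v) x) (ren-id x)

  -- With no reduction rules in the signature, the initial reduction monad orders terms discretely.
  termMonad : ReductionMonad Ty₀
  termMonad = record
    { P          = λ V t → record { ∣_∣ = Tm V t ; _≤_ = _≡_ ; ≤-refl = refl ; ≤-trans = trans }
    ; η          = λ t v → var v
    ; σ          = λ f t x → sub f x
    ; σ-mono     = λ f t → cong (sub f)
    ; σ-monotone = λ f g e t → sub-cong e
    ; σ-cong     = λ f g e t → sub-cong e
    ; η-σ        = λ f t x → refl
    ; σ-η        = λ t → sub-id
    ; σ-σ        = λ f g t → sub-∘ f g
    }

  shift*-termMonad : ∀ {V W} (L : List Ty₀) (f : Sub V W) → shift* termMonad L f ≐ lift* L f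
  shift*-termMonad []      f t x = refl
  shift*-termMonad (s ∷ L) f t x =
    trans (ReductionMonadProperties.shift*-cong termMonad L shift-lift t x) (shift*-termMonad L (lift s f) t x)
    where
    shift-lift : shift termMonad s f ≐ lift s f
    shift-lift t (inj₁ v) = sub-var (λ _ → inj₁) (f t v)
    shift-lift t (inj₂ q) = refl

  module _ {n : ℕ} (u : Vec Ty₀ n) where

    fromArgs : ∀ {V} ps → ∣ ArgsPO closedTypes termMonad u ps V ∣ → Args V u ps
    fromArgs []              _        = []
    fromArgs ((ss , t) ∷ ps) (x , xs) = x ∷ fromArgs ps xs

    toArgs : ∀ {V ps} → Args V u ps → ∣ ArgsPO closedTypes termMonad u ps V ∣
    toArgs []       = tt
    toArgs (a ∷ as) = a , toArgs as

    fromArgs-toArgs : ∀ {V ps} (as : Args V u ps) → fromArgs ps (toArgs as) ≡ as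
    fromArgs-toArgs []       = refl
    fromArgs-toArgs (a ∷ as) = cong (a ∷_) (fromArgs-toArgs as)

    fromArgs-mono : ∀ {V} ps {xs ys} → _≤_ (ArgsPO closedTypes termMonad u ps V) xs ys →
                    fromArgs ps xs ≡ fromArgs ps ys
    fromArgs-mono []              e        = refl
    fromArgs-mono ((ss , t) ∷ ps) (e , es) = cong₂ _∷_ e (fromArgs-mono ps es)

    fromArgs-substArgs : ∀ {V W} ps (f : Sub V W) xs →
                         fromArgs ps (substArgs closedTypes termMonad u ps f xs) ≡ subArgs f (fromArgs ps xs)
    fromArgs-substArgs []              f xs       = refl
    fromArgs-substArgs ((ss , t) ∷ ps) f (x , xs) =
      cong₂ _∷_ (sub-cong (shift*-termMonad (binderTypes u ss) f) x) (fromArgs-substArgs ps f xs)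

  conRep : (i : Idx Sg) (u : Vec Ty₀ (deg Sg i)) → AritySlot closedTypes termMonad u (arity Sg i)
  conRep i u = record
    { act      = λ xs → con i u (fromArgs u _ xs)
    ; act-mono = λ e → cong (con i u) (fromArgs-mono u _ e)
    ; act-nat  = λ f xs → cong (con i u) (fromArgs-substArgs u _ f xs)
    }

  syntaxRep : Rep Sg
  syntaxRep = record { base = record { rep = closedTypes ; monad = termMonad } ; arep = conRep }

module Initiation (Sg : TypedSig) (ℛ : Rep Sg) where
  open Syntax Sg

  TR : AlgRep S
  TR = rep (base ℛ)

  Q : ReductionMonad (Ty TR)
  Q = monad (base ℛ)

  open ReductionMonadProperties Q

  evalClosed : Ty₀ → Ty TR
  evalClosed e = ⟦ e ⟧ TR []

  evalClosed* : ∀ {k} (es : Vec Ty₀ k) → ⟦ es ⟧* TR [] ≡ Vec.map evalClosed es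
  evalClosed* []       = refl
  evalClosed* (e ∷ es) = cong (evalClosed e ∷_) (evalClosed* es)

  evalClosedHom : AlgRepHom closedTypes TR
  evalClosedHom = record { fun = evalClosed ; hom = λ j es → cong (op TR j) (evalClosed* es) }

  mutual
    evalClosed-unique : (h : AlgRepHom closedTypes TR) (t : Ty₀) → fun h t ≡ evalClosed t
    evalClosed-unique h (var ())
    evalClosed-unique h (node j es) =
      trans (hom h j es) (cong (op TR j) (trans (evalClosed-unique* h es) (sym (evalClosed* es))))

    evalClosed-unique* : (h : AlgRepHom closedTypes TR) {k : ℕ} (es : Vec Ty₀ k) →
                         Vec.map (fun h) es ≡ Vec.map evalClosed es
    evalClosed-unique* h []       = refl
    evalClosed-unique* h (e ∷ es) = cong₂ _∷_ (evalClosed-unique h e) (evalClosed-unique* h es)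

  binderTypes-hom : ∀ {n} (u : Vec Ty₀ n) (ss : List (TyExpr S n)) →
                    List.map evalClosed (binderTypes u ss) ≡ List.map (λ e → ⟦ e ⟧ TR (Vec.map evalClosed u)) ss
  binderTypes-hom u []       = refl
  binderTypes-hom u (e ∷ ss) = cong₂ _∷_ (eval-hom evalClosedHom e u) (binderTypes-hom u ss)

  mutual
    interp : ∀ {V t} → Tm V t → El ((evalClosed !) V) (evalClosed t)
    interp (var {t} v)        = η Q (evalClosed t) (t , refl , v)
    interp {V} (con i u as) =
      subst (El ((evalClosed !) V)) (sym (eval-hom evalClosedHom (result (arity Sg i)) u))
            (act (arep ℛ i (Vec.map evalClosed u)) (interpArgs as))

    interpArgs : ∀ {V n} {u : Vec Ty₀ n} {ps} → Args V u ps →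
                 ∣ ArgsPO TR Q (Vec.map evalClosed u) ps ((evalClosed !) V) ∣
    interpArgs []       = tt
    interpArgs {u = u} (_∷_ {ss = ss} {t} a as) = interpPremise {u = u} {ss} {t} a , interpArgs as

    interpPremise : ∀ {V n} {u : Vec Ty₀ n} {ss t} → Tm (V ** binderTypes u ss) (⟦ t ⟧ closedTypes u) →
                    El** ((evalClosed !) V) (List.map (λ e → ⟦ e ⟧ TR (Vec.map evalClosed u)) ss)
                         (⟦ t ⟧ TR (Vec.map evalClosed u))
    interpPremise {V} {u = u} {ss} {t} a =
      subst₂ (El** ((evalClosed !) V)) (binderTypes-hom u ss) (eval-hom evalClosedHom t u)
             (map Q (!-** evalClosed (binderTypes u ss)) _ (interp a))

  interp-con-natural : ∀ {V W} (k : KHom Q ((evalClosed !) V) ((evalClosed !) W))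
                       (i : Idx Sg) (u : Vec Ty₀ (deg Sg i)) (as : Args V u (premises (arity Sg i)))
                       (bs : Args W u (premises (arity Sg i))) →
                       interpArgs bs ≡ substArgs TR Q (Vec.map evalClosed u) (premises (arity Sg i)) k (interpArgs as) →
                       interp (con i u bs) ≡ σ Q k _ (interp (con i u as))
  interp-con-natural {W = W} k i u as bs e =
    trans (cong actᵂ e)
          (trans (cong (subst (El ((evalClosed !) W)) (sym Eq)) (act-nat 𝒜 k (interpArgs as)))
                 (sym (σ-subst k (sym Eq) _)))
    where
    Eq = eval-hom evalClosedHom (result (arity Sg i)) u
    𝒜 = arep ℛ i (Vec.map evalClosed u)
    actᵂ : ∣ ArgsPO TR Q (Vec.map evalClosed u) (premises (arity Sg i)) ((evalClosed !) W) ∣ →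
           El ((evalClosed !) W) (evalClosed (⟦ result (arity Sg i) ⟧ closedTypes u))
    actᵂ xs = subst (El ((evalClosed !) W)) (sym Eq) (act 𝒜 xs)

  interpPremise-natural : ∀ {V W n} {u : Vec Ty₀ n} {ss t} (k : KHom Q ((evalClosed !) V) ((evalClosed !) W))
                          (a : Tm (V ** binderTypes u ss) (⟦ t ⟧ closedTypes u))
                          (b : Tm (W ** binderTypes u ss) (⟦ t ⟧ closedTypes u)) →
                          map Q (!-** evalClosed (binderTypes u ss)) _ (interp b) ≡
                          σ Q (shift* Q (List.map evalClosed (binderTypes u ss)) k) _
                            (map Q (!-** evalClosed (binderTypes u ss)) _ (interp a)) →
                          interpPremise {u = u} {ss} {t} b ≡
                          σ Q (shift* Q (List.map (λ e → ⟦ e ⟧ TR (Vec.map evalClosed u)) ss) k) _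
                            (interpPremise {u = u} {ss} {t} a)
  interpPremise-natural {W = W} {u = u} {ss} {t} k a b e =
    trans (cong (subst₂ (El** ((evalClosed !) W)) (binderTypes-hom u ss) (eval-hom evalClosedHom t u)) e)
          (sym (σ-shift*-subst₂ k (binderTypes-hom u ss) (eval-hom evalClosedHom t u) _))

  interpRen : ∀ {V W} → V ⇛ W → KHom Q ((evalClosed !) V) ((evalClosed !) W)
  interpRen ρ t x = η Q t (!-map evalClosed ρ t x)

  mutual
    interp-ren : ∀ {V W} (ρ : V ⇛ W) {t} (x : Tm V t) →
                 interp (ren ρ x) ≡ map Q (!-map evalClosed ρ) (evalClosed t) (interp x)
    interp-ren ρ (var {t} v)  = sym (map-η (!-map evalClosed ρ) _ (t , refl , v))
    interp-ren ρ (con i u as) =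
      interp-con-natural (interpRen ρ) i u as (renArgs ρ as) (interpArgs-ren ρ as)

    interpArgs-ren : ∀ {V W n} {u : Vec Ty₀ n} {ps} (ρ : V ⇛ W) (as : Args V u ps) →
                     interpArgs (renArgs ρ as) ≡
                     substArgs TR Q (Vec.map evalClosed u) ps (interpRen ρ) (interpArgs as)
    interpArgs-ren ρ []                                = refl
    interpArgs-ren {u = u} ρ (_∷_ {ss = ss} {t} a as) =
      cong₂ _,_ (interpPremise-natural {u = u} {ss} {t} _ a (ren (**-map (binderTypes u ss) ρ) a)
                                        (interp-ren-under-binders (binderTypes u ss) ρ a))
                (interpArgs-ren ρ as)

    interp-ren-under-binders : ∀ {V W t} (L : List Ty₀) (ρ : V ⇛ W) (a : Tm (V ** L) t) →
                               map Q (!-** evalClosed L) _ (interp (ren (**-map L ρ) a)) ≡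
                               σ Q (shift* Q (List.map evalClosed L) (interpRen ρ)) _
                                 (map Q (!-** evalClosed L) _ (interp a))
    interp-ren-under-binders L ρ a = begin
      map Q (!-** evalClosed L) _ (interp (ren (**-map L ρ) a))
        ≡⟨ cong (map Q (!-** evalClosed L) _) (interp-ren (**-map L ρ) a) ⟩
      map Q (!-** evalClosed L) _ (map Q (!-map evalClosed (**-map L ρ)) _ (interp a))
        ≡⟨ map-∘ _ _ _ (interp a) ⟩
      map Q (λ t x → !-** evalClosed L t (!-map evalClosed (**-map L ρ) t x)) _ (interp a)
        ≡⟨ map-cong (!-**-natural evalClosed L ρ) _ (interp a) ⟩
      map Q (λ t x → **-map (List.map evalClosed L) (!-map evalClosed ρ) t (!-** evalClosed L t x)) _ (interp a)
        ≡⟨ sym (σ-cong Q _ _ (λ t x → shift*-η (List.map evalClosed L) (!-map evalClosed ρ) t (!-** evalClosed L t x))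
                        _ (interp a)) ⟩
      σ Q (λ t x → shift* Q (List.map evalClosed L) _ t (!-** evalClosed L t x)) _ (interp a)
        ≡⟨ sym (σ-map (!-** evalClosed L) _ _ (interp a)) ⟩
      σ Q (shift* Q (List.map evalClosed L) _) _ (map Q (!-** evalClosed L) _ (interp a)) ∎
      where open ≡-Reasoning

  interpSub : ∀ {V W} → Sub V W → KHom Q ((evalClosed !) V) ((evalClosed !) W)
  interpSub {W = W} f t′ (t , p , v) = subst (El ((evalClosed !) W)) p (interp (f t v))

  interpSub-lift* : ∀ {V W} (L : List Ty₀) (f : Sub V W) →
                    (λ t′ z → map Q (!-** evalClosed L) t′ (interpSub (lift* L f) t′ z)) ≐
                    (λ t′ z → shift* Q (List.map evalClosed L) (interpSub f) t′ (!-** evalClosed L t′ z))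
  interpSub-lift* []      f t′ z = map-id t′ _
  interpSub-lift* {V} {W} (s ∷ L) f t′ z =
    trans (sym (map-∘ (!-** evalClosed L) (**-map (List.map evalClosed L) (!-* evalClosed s)) t′ _))
          (trans (cong (map Q (**-map (List.map evalClosed L) (!-* evalClosed s)) t′)
                       (interpSub-lift* L (lift s f) t′ z))
                 (shift*-natural (List.map evalClosed L) (!-* evalClosed s) (!-* evalClosed s)
                                 (interpSub (lift s f)) (shift Q (evalClosed s) (interpSub f)) interpSub-lift t′ _))
    where
    Elᵂ = El ((evalClosed !) (W * s))

    fresh : ∀ {t₀} (e : s ≡ t₀) {t} (p : evalClosed t₀ ≡ t) →
            map Q (!-* evalClosed {W} s) t (subst Elᵂ p (η Q (evalClosed t₀) (t₀ , refl , inj₂ e))) ≡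
            η Q t (inj₂ (trans (cong evalClosed e) p))
    fresh e refl = map-η _ _ _

    interpSub-lift : (λ t z → map Q (!-* evalClosed {W} s) t (interpSub (lift s f) t z)) ≐
                     (λ t z → shift Q (evalClosed s) (interpSub f) t (!-* evalClosed {V} s t z))
    interpSub-lift t (t₀ , p , inj₁ w) = begin
      map Q (!-* evalClosed s) t (subst Elᵂ p (interp (ren (λ _ → inj₁) (f t₀ w))))
        ≡⟨ σ-subst _ p _ ⟩
      subst (El ((evalClosed !) W * evalClosed s)) p (map Q (!-* evalClosed s) _ (interp (ren (λ _ → inj₁) (f t₀ w))))
        ≡⟨ cong (subst (El ((evalClosed !) W * evalClosed s)) p)
                (trans (cong (map Q (!-* evalClosed s) _) (interp-ren (λ _ → inj₁) (f t₀ w)))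
                       (map-∘ _ _ _ (interp (f t₀ w)))) ⟩
      subst (El ((evalClosed !) W * evalClosed s)) p (map Q (λ _ → inj₁) _ (interp (f t₀ w)))
        ≡⟨ sym (σ-subst _ p _) ⟩
      map Q (λ _ → inj₁) t (subst (El ((evalClosed !) W)) p (interp (f t₀ w))) ∎
      where open ≡-Reasoning
    interpSub-lift t (t₀ , p , inj₂ e) = fresh e p

  mutual
    interp-sub : ∀ {V W} (f : Sub V W) {t} (x : Tm V t) →
                 interp (sub f x) ≡ σ Q (interpSub f) (evalClosed t) (interp x)
    interp-sub f (var {t} v)  = sym (η-σ Q (interpSub f) _ (t , refl , v))
    interp-sub f (con i u as) = interp-con-natural (interpSub f) i u as (subArgs f as) (interpArgs-sub f as)

    interpArgs-sub : ∀ {V W n} {u : Vec Ty₀ n} {ps} (f : Sub V W) (as : Args V u ps) →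
                     interpArgs (subArgs f as) ≡ substArgs TR Q (Vec.map evalClosed u) ps (interpSub f) (interpArgs as)
    interpArgs-sub f []                                       = refl
    interpArgs-sub {u = u} f (_∷_ {ss = ss} {t} a as) =
      cong₂ _,_ (interpPremise-natural {u = u} {ss} {t} _ a (sub (lift* (binderTypes u ss) f) a)
                                        (interp-sub-under-binders (binderTypes u ss) f a))
                (interpArgs-sub f as)

    interp-sub-under-binders : ∀ {V W t} (L : List Ty₀) (f : Sub V W) (a : Tm (V ** L) t) →
                               map Q (!-** evalClosed L) _ (interp (sub (lift* L f) a)) ≡
                               σ Q (shift* Q (List.map evalClosed L) (interpSub f)) _
                                 (map Q (!-** evalClosed L) _ (interp a))
    interp-sub-under-binders L f a = begin
      map Q (!-** evalClosed L) _ (interp (sub (lift* L f) a))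
        ≡⟨ cong (map Q (!-** evalClosed L) _) (interp-sub (lift* L f) a) ⟩
      map Q (!-** evalClosed L) _ (σ Q (interpSub (lift* L f)) _ (interp a))
        ≡⟨ map-σ _ _ _ (interp a) ⟩
      σ Q (λ t x → map Q (!-** evalClosed L) t (interpSub (lift* L f) t x)) _ (interp a)
        ≡⟨ σ-cong Q _ _ (interpSub-lift* L f) _ (interp a) ⟩
      σ Q (λ t x → shift* Q (List.map evalClosed L) (interpSub f) t (!-** evalClosed L t x)) _ (interp a)
        ≡⟨ sym (σ-map (!-** evalClosed L) _ _ (interp a)) ⟩
      σ Q (shift* Q (List.map evalClosed L) (interpSub f)) _ (map Q (!-** evalClosed L) _ (interp a)) ∎
      where open ≡-Reasoning

  interpColax : ColaxMor evalClosed termMonad Q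
  interpColax = record
    { fhat      = λ t → interp
    ; fhat-mono = λ { {V} t refl → ≤-refl (P Q ((evalClosed !) V) (evalClosed t)) }
    ; fhat-η    = λ t v → refl
    ; fhat-σ    = λ f t → interp-sub f
    }

  interpMor : RelSMonadMor (base syntaxRep) (base ℛ)
  interpMor = record { g = evalClosedHom ; f = interpColax }

  interpArgs-fromArgs : ∀ {V n} (u : Vec Ty₀ n) ps (xs : ∣ ArgsPO closedTypes termMonad u ps V ∣) →
                        interpArgs (fromArgs u ps xs) ≡ fhatArgs interpMor u ps xs
  interpArgs-fromArgs u []              xs       = refl
  interpArgs-fromArgs {V} u ((ss , t) ∷ ps) (x , xs) =
    cong₂ _,_ (subst₂-irrelevant (El** ((evalClosed !) V)) (binderTypes-hom u ss) (evalL-hom interpMor u ss)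
                                  (eval-hom evalClosedHom t u) (eval-hom evalClosedHom t u) _) (interpArgs-fromArgs u ps xs)

  interpRepMor : RepMor syntaxRep ℛ
  interpRepMor = record
    { mor      = interpMor
    ; commutes = λ i u {V} xs →
        trans (subst-subst-sym (eval-hom evalClosedHom (result (arity Sg i)) u))
              (cong (act (arep ℛ i (Vec.map evalClosed u))) (interpArgs-fromArgs u _ xs))
    }

module Uniqueness (Sg : TypedSig) (ℛ : Rep Sg) where
  open Syntax Sg
  open Initiation Sg ℛ
  open ReductionMonadProperties Q

  act-subst : ∀ {V} (i : Idx Sg) {u₁ u₂ : Vec (Ty TR) (deg Sg i)} (q : u₁ ≡ u₂)
              (xs₁ : ∣ ArgsPO TR Q u₁ (premises (arity Sg i)) V ∣)
              (xs₂ : ∣ ArgsPO TR Q u₂ (premises (arity Sg i)) V ∣) →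
              subst (λ w → ∣ ArgsPO TR Q w (premises (arity Sg i)) V ∣) q xs₁ ≡ xs₂ →
              ∀ {τ} (e₁ : ⟦ result (arity Sg i) ⟧ TR u₁ ≡ τ) (e₂ : ⟦ result (arity Sg i) ⟧ TR u₂ ≡ τ) →
              subst (El V) e₁ (act (arep ℛ i u₁) xs₁) ≡ subst (El V) e₂ (act (arep ℛ i u₂) xs₂)
  act-subst i refl xs₁ .xs₁ refl e₁ e₂ = cong (λ e → subst (El _) e (act (arep ℛ i _) xs₁)) (uip e₁ e₂)

  module _ (m : RepMor syntaxRep ℛ) where
    private
      h = g (mor m)

    fhat-con : ∀ {V} (i : Idx Sg) (u : Vec Ty₀ (deg Sg i)) (as : Args V u (premises (arity Sg i))) →
               fhat (f (mor m)) _ (con i u as) ≡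
               subst (El ((fun h !) V)) (sym (eval-hom h (result (arity Sg i)) u))
                     (act (arep ℛ i (Vec.map (fun h) u)) (fhatArgs (mor m) u (premises (arity Sg i)) (toArgs u as)))
    fhat-con {V} i u as = begin
      fhat (f (mor m)) _ (con i u as)
        ≡⟨ cong (λ as → fhat (f (mor m)) _ (con i u as)) (sym (fromArgs-toArgs u as)) ⟩
      fhat (f (mor m)) _ (act (conRep i u) xs)
        ≡⟨ sym (subst-sym-subst Eq) ⟩
      subst (El C) (sym Eq) (subst (El C) Eq (fhat (f (mor m)) _ (act (conRep i u) xs)))
        ≡⟨ cong (subst (El C) (sym Eq)) (commutes m i u xs) ⟩
      subst (El C) (sym Eq) (act (arep ℛ i (Vec.map (fun h) u)) (fhatArgs (mor m) u (premises (arity Sg i)) xs)) ∎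
      where
      open ≡-Reasoning
      C  = (fun h !) V
      Eq = eval-hom h (result (arity Sg i)) u
      xs = toArgs u as

  module _ (m₁ m₂ : RepMor syntaxRep ℛ) where
    private
      h₁ = g (mor m₁)
      h₂ = g (mor m₂)
      g₁ = fun h₁
      g₂ = fun h₂
      fhat₁ = fhat (f (mor m₁))
      fhat₂ = fhat (f (mor m₂))

    agree : ∀ t → g₁ t ≡ g₂ t
    agree t = trans (evalClosed-unique h₁ t) (sym (evalClosed-unique h₂ t))

    agree-vec : ∀ {k} (u : Vec Ty₀ k) → Vec.map g₁ u ≡ Vec.map g₂ u
    agree-vec u = trans (evalClosed-unique* h₁ u) (sym (evalClosed-unique* h₂ u))

    agree-list : (L : List Ty₀) → Pointwise _≡_ (List.map g₁ L) (List.map g₂ L)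
    agree-list []      = []
    agree-list (s ∷ L) = agree s ∷ agree-list L

    -- The type maps agree only pointwise, so the term maps are compared along this identification,
    -- the one used by _≈Mor_.
    retype : ∀ {V : Ctx Ty₀} → (g₁ !) V ⇛ (g₂ !) V
    retype t′ (t , q , v) = t , trans (sym (agree t)) q , v

    retype-!-** : ∀ {V : Ctx Ty₀} (L : List Ty₀) →
                  (λ t z → **-cast (agree-list L) t (**-map (List.map g₁ L) (retype {V}) t (!-** g₁ L t z))) ≐
                  (λ t z → !-** g₂ L t (retype {V ** L} t z))
    retype-!-** []      t z = refl
    retype-!-** {V} (s ∷ L) t z =
      trans (cong (**-cast (agree-list L) t)
                  (trans (cong (**-map (List.map g₁ L) (*-cast (agree s)) t) (**-map-∘ (List.map g₁ L) _ _ t _))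
                         (**-map-square (List.map g₁ L) retype-!-* t _)))
            (trans (**-cast-natural (agree-list L) (!-* g₂ s) t _)
                   (cong (**-map (List.map g₂ L) (!-* g₂ s) t) (retype-!-** {V * s} L t z)))
      where
      retype-!-* : (λ t x → *-cast {C = (g₂ !) V} (agree s) t (*-map (g₁ s) retype t (!-* g₁ {V} s t x))) ≐
                   (λ t x → !-* g₂ {V} s t (retype {V * s} t x))
      retype-!-* t (t₀ , q , inj₁ v) = refl
      retype-!-* t (t₀ , q , inj₂ e) = cong inj₂ (uip _ _)

    η∘retype : ∀ {V} → KHom Q ((g₁ !) V) ((g₂ !) V)
    η∘retype t x = η Q t (retype t x)

    mutual
      fhat-agree : ∀ {V} t (x : Tm V t) →
                   subst (El ((g₂ !) V)) (agree t) (map Q retype (g₁ t) (fhat₁ t x)) ≡ fhat₂ t x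
      fhat-agree {V} t (var v) = begin
        subst (El ((g₂ !) V)) (agree t) (map Q retype (g₁ t) (fhat₁ t (var v)))
          ≡⟨ cong (λ z → subst (El ((g₂ !) V)) (agree t) (map Q retype (g₁ t) z)) (fhat-η (f (mor m₁)) t v) ⟩
        subst (El ((g₂ !) V)) (agree t) (map Q retype (g₁ t) (η Q (g₁ t) (t , refl , v)))
          ≡⟨ cong (subst (El ((g₂ !) V)) (agree t)) (map-η retype _ _) ⟩
        subst (El ((g₂ !) V)) (agree t) (η Q (g₁ t) (t , trans (sym (agree t)) refl , v))
          ≡⟨ η-retyped (agree t) ⟩
        η Q (g₂ t) (t , refl , v)
          ≡⟨ sym (fhat-η (f (mor m₂)) t v) ⟩
        fhat₂ t (var v) ∎
        where
        open ≡-Reasoning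
        η-retyped : ∀ {a} (q : a ≡ g₂ t) →
                    subst (El ((g₂ !) V)) q (η Q a (t , trans (sym q) refl , v)) ≡ η Q (g₂ t) (t , refl , v)
        η-retyped refl = refl
      fhat-agree {V} _ (con i u as) = begin
        subst (El C) (agree t₀) (map Q retype (g₁ t₀) (fhat₁ t₀ (con i u as)))
          ≡⟨ cong (λ z → subst (El C) (agree t₀) (map Q retype (g₁ t₀) z)) (fhat-con m₁ i u as) ⟩
        subst (El C) (agree t₀) (map Q retype (g₁ t₀) (subst (El ((g₁ !) V)) (sym Eq₁) (act 𝒜₁ xs₁)))
          ≡⟨ cong (subst (El C) (agree t₀)) (σ-subst η∘retype (sym Eq₁) _) ⟩
        subst (El C) (agree t₀) (subst (El C) (sym Eq₁) (map Q retype _ (act 𝒜₁ xs₁)))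
          ≡⟨ cong (λ z → subst (El C) (agree t₀) (subst (El C) (sym Eq₁) z)) (sym (act-nat 𝒜₁ η∘retype xs₁)) ⟩
        subst (El C) (agree t₀) (subst (El C) (sym Eq₁) (act 𝒜₁ (substArgs TR Q (Vec.map g₁ u) ps η∘retype xs₁)))
          ≡⟨ subst-subst {P = El C} (sym Eq₁) ⟩
        subst (El C) (trans (sym Eq₁) (agree t₀)) (act 𝒜₁ (substArgs TR Q (Vec.map g₁ u) ps η∘retype xs₁))
          ≡⟨ act-subst i (agree-vec u) _ _ (fhatArgs-agree u as) _ (sym Eq₂) ⟩
        subst (El C) (sym Eq₂) (act 𝒜₂ xs₂)
          ≡⟨ sym (fhat-con m₂ i u as) ⟩
        fhat₂ t₀ (con i u as) ∎
        where
        open ≡-Reasoning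
        C   = (g₂ !) V
        ps  = premises (arity Sg i)
        t₀  = ⟦ result (arity Sg i) ⟧ closedTypes u
        Eq₁ = eval-hom h₁ (result (arity Sg i)) u
        Eq₂ = eval-hom h₂ (result (arity Sg i)) u
        𝒜₁  = arep ℛ i (Vec.map g₁ u)
        𝒜₂  = arep ℛ i (Vec.map g₂ u)
        xs₁ = fhatArgs (mor m₁) u ps (toArgs u as)
        xs₂ = fhatArgs (mor m₂) u ps (toArgs u as)

      fhatArgs-agree : ∀ {V n} (u : Vec Ty₀ n) {ps} (as : Args V u ps) →
                       subst (λ w → ∣ ArgsPO TR Q w ps ((g₂ !) V) ∣) (agree-vec u)
                             (substArgs TR Q (Vec.map g₁ u) ps η∘retype (fhatArgs (mor m₁) u ps (toArgs u as)))
                       ≡ fhatArgs (mor m₂) u ps (toArgs u as)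
      fhatArgs-agree u []                                    = refl
      fhatArgs-agree {V} u (_∷_ {ss = ss} {t} {ps} a as) =
        trans (subst-× (λ w → El** ((g₂ !) V) (List.map (λ e → ⟦ e ⟧ TR w) ss) (⟦ t ⟧ TR w))
                       (λ w → ∣ ArgsPO TR Q w ps ((g₂ !) V) ∣) (agree-vec u) _ _)
              (cong₂ _,_ (fhatPremise-agree u ss t a) (fhatArgs-agree u as))

      fhatPremise-agree : ∀ {V n} (u : Vec Ty₀ n) (ss : List (TyExpr S n)) (t : TyExpr S n)
                          (a : Tm (V ** binderTypes u ss) (⟦ t ⟧ closedTypes u)) →
                          subst (λ w → El** ((g₂ !) V) (List.map (λ e → ⟦ e ⟧ TR w) ss) (⟦ t ⟧ TR w)) (agree-vec u)
                            (σ Q (shift* Q (List.map (λ e → ⟦ e ⟧ TR (Vec.map g₁ u)) ss) η∘retype) _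
                               (subst₂ (El** ((g₁ !) V)) (evalL-hom (mor m₁) u ss) (eval-hom h₁ t u)
                                       (map Q (!-** g₁ (binderTypes u ss)) _ (fhat₁ _ a))))
                          ≡ subst₂ (El** ((g₂ !) V)) (evalL-hom (mor m₂) u ss) (eval-hom h₂ t u)
                                   (map Q (!-** g₂ (binderTypes u ss)) _ (fhat₂ _ a))
      fhatPremise-agree {V} u ss t a = begin
        subst (λ w → El** C (LR w) (⟦ t ⟧ TR w)) (agree-vec u)
          (σ Q (shift* Q (LR (Vec.map g₁ u)) η∘retype) _ (subst₂ (El** ((g₁ !) V)) eL₁ et₁ (map Q (!-** g₁ L) _ y)))
          ≡⟨ subst-∘-as-subst₂ (El** C) LR (⟦ t ⟧ TR) (agree-vec u) _ ⟩
        subst₂ (El** C) cL cτ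
          (σ Q (shift* Q (LR (Vec.map g₁ u)) η∘retype) _ (subst₂ (El** ((g₁ !) V)) eL₁ et₁ (map Q (!-** g₁ L) _ y)))
          ≡⟨ cong (subst₂ (El** C) cL cτ) (σ-shift*-subst₂ η∘retype eL₁ et₁ _) ⟩
        subst₂ (El** C) cL cτ (subst₂ (El** C) eL₁ et₁ (σ Q (shift* Q mL₁ η∘retype) _ (map Q (!-** g₁ L) _ y)))
          ≡⟨ cong (λ z → subst₂ (El** C) cL cτ (subst₂ (El** C) eL₁ et₁ z)) retype-under-binders ⟩
        subst₂ (El** C) cL cτ (subst₂ (El** C) eL₁ et₁ (map Q ρ₁ _ y))
          ≡⟨ subst₂-subst₂-irrelevant (El** C) eL₁ et₁ cL cτ qL refl eL₂ (trans (agree τ₀) et₂) _ ⟩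
        subst₂ (El** C) eL₂ (trans (agree τ₀) et₂) (subst₂ (El** C) qL refl (map Q ρ₁ _ y))
          ≡⟨ cong (subst₂ (El** C) eL₂ (trans (agree τ₀) et₂)) cast-under-binders ⟩
        subst₂ (El** C) eL₂ (trans (agree τ₀) et₂) (map Q ρ₂ _ y)
          ≡⟨ fhat₂-under-binders ⟩
        subst₂ (El** C) eL₂ et₂ (map Q (!-** g₂ L) _ (fhat₂ _ a)) ∎
        where
        open ≡-Reasoning
        C   = (g₂ !) V
        L   = binderTypes u ss
        mL₁ = List.map g₁ L
        mL₂ = List.map g₂ L
        LR  = λ w → List.map (λ e → ⟦ e ⟧ TR w) ss
        τ₀  = ⟦ t ⟧ closedTypes u
        y   = fhat₁ τ₀ a
        eL₁ = evalL-hom (mor m₁) u ss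
        eL₂ = evalL-hom (mor m₂) u ss
        et₁ = eval-hom h₁ t u
        et₂ = eval-hom h₂ t u
        cL  = cong LR (agree-vec u)
        cτ  = cong (⟦ t ⟧ TR) (agree-vec u)
        qL  = Pointwise-≡⇒≡ (agree-list L)

        ρ₁ : (g₁ !) (V ** L) ⇛ (C ** mL₁)
        ρ₁ t z = **-map mL₁ retype t (!-** g₁ L t z)

        ρ₂ : (g₁ !) (V ** L) ⇛ (C ** mL₂)
        ρ₂ t z = !-** g₂ L t (retype t z)

        retype-under-binders : σ Q (shift* Q mL₁ η∘retype) _ (map Q (!-** g₁ L) _ y) ≡ map Q ρ₁ _ y
        retype-under-binders =
          trans (σ-map (!-** g₁ L) (shift* Q mL₁ η∘retype) _ y)
                (σ-cong Q _ _ (λ t z → shift*-η mL₁ retype t (!-** g₁ L t z)) _ y)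

        cast-under-binders : subst₂ (El** C) qL refl (map Q ρ₁ _ y) ≡ map Q ρ₂ _ y
        cast-under-binders =
          trans (subst-**-as-map qL (agree-list L) _)
                (trans (map-∘ ρ₁ (**-cast (agree-list L)) _ y) (map-cong (retype-!-** L) _ y))

        fhat₂-under-binders : subst₂ (El** C) eL₂ (trans (agree τ₀) et₂) (map Q ρ₂ _ y) ≡
                              subst₂ (El** C) eL₂ et₂ (map Q (!-** g₂ L) _ (fhat₂ _ a))
        fhat₂-under-binders = begin
          subst₂ (El** C) eL₂ (trans (agree τ₀) et₂) (map Q ρ₂ _ y)
            ≡⟨ sym (subst₂-subst₂ (El** C) (refl {x = mL₂}) (agree τ₀) eL₂ et₂ _) ⟩
          subst₂ (El** C) eL₂ et₂ (subst₂ (El** C) (refl {x = mL₂}) (agree τ₀) (map Q ρ₂ _ y))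
            ≡⟨ cong (subst₂ (El** C) eL₂ et₂) (sym (subst-as-subst₂ (El** C) (agree τ₀) _)) ⟩
          subst₂ (El** C) eL₂ et₂ (subst (El** C mL₂) (agree τ₀) (map Q ρ₂ _ y))
            ≡⟨ cong (λ z → subst₂ (El** C) eL₂ et₂ (subst (El** C mL₂) (agree τ₀) z))
                    (sym (map-∘ retype (!-** g₂ L) _ y)) ⟩
          subst₂ (El** C) eL₂ et₂ (subst (El** C mL₂) (agree τ₀) (map Q (!-** g₂ L) _ (map Q retype _ y)))
            ≡⟨ cong (subst₂ (El** C) eL₂ et₂) (sym (σ-subst _ (agree τ₀) _)) ⟩
          subst₂ (El** C) eL₂ et₂ (map Q (!-** g₂ L) _ (subst (El ((g₂ !) (V ** L))) (agree τ₀) (map Q retype _ y)))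
            ≡⟨ cong (λ z → subst₂ (El** C) eL₂ et₂ (map Q (!-** g₂ L) _ z)) (fhat-agree τ₀ a) ⟩
          subst₂ (El** C) eL₂ et₂ (map Q (!-** g₂ L) _ (fhat₂ _ a)) ∎

    repMor-unique : m₁ ≈Mor m₂
    repMor-unique = record { g-eq = agree ; f-eq = fhat-agree }

lemma3p20 : (Sg : TypedSig) → HasInitial Sg
lemma3p20 Sg = syntaxRep , λ ℛ → interpRepMor ℛ , repMor-unique ℛ
  where
  open Syntax Sg
  open Initiation Sg
  open Uniqueness Sg
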